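{- Let $p$ be an odd prime. There are exactly 5 orbits of the adjoint (conjugation) action of $B$ on the set of one-dimensional subspaces of $V$. In the coordinates $(b,a,c)$ described in the context, a complete list of orbits, with cardinalities and representatives, is: (a) $\langle(1,0,0)\rangle$ (the strictly upper-triangular matrices), an orbit of cardinality $1$; (b) the lines $\langle(b,1,0)\rangle$ for $b\in\mathbb{F}_p$ (lines of upper-triangular but not strictly upper-triangular matrices), together an orbit of cardinality $p$; (c) the lines $\langle(-a^2,a,1)\rangle$ for $a\in\mathbb{F}_p$, together an orbit of cardinality $p$; (d) an orbit of cardinality $p(p-1)/2$ with representative $\langle(1,0,1)\rangle$; (e) an orbit of cardinality $p(p-1)/2$ with representative $\langle(b,0,1)\rangle$, where $b\in\mathbb{F}_p^\times$ is a non-square. When $p\ge5$, the orbit (c) is the only orbit of cardinality $p$ whose members do not consist entirely of upper-triangular matrices.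
   Context: $V\subset M_2(\mathbb{F}_p)$ is the 3-dimensional $\mathbb{F}_p$-space of trace-zero matrices, and $B=\left\{\begin{pmatrix}x&y\\0&1\end{pmatrix}:x\in\mathbb{F}_p^\times,y\in\mathbb{F}_p\right\}\subset\mathrm{GL}_2(\mathbb{F}_p)$ acts on $V$ by conjugation. Coordinates: $(b,a,c)$ denotes $b\begin{pmatrix}0&1\\0&0\end{pmatrix}+a\begin{pmatrix}1&0\\0&-1\end{pmatrix}+c\begin{pmatrix}0&0\\1&0\end{pmatrix}$. -}

module Defs where

open import Data.Nat using (ℕ; _∸_; NonZero) renaming (_+_ to _+ℕ_; _*_ to _*ℕ_)
open import Data.Nat.DivMod using (_mod_)
open import Data.Fin using (Fin; toℕ)
open import Data.Product using (_×_; _,_; Σ; ∃; proj₁; proj₂)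
open import Data.List using (List; length)
open import Data.List.Relation.Unary.All using (All)
open import Data.List.Relation.Unary.Any using (Any)
open import Data.List.Relation.Unary.AllPairs using (AllPairs)
open import Relation.Binary.PropositionalEquality using (_≡_; _≢_)
open import Relation.Nullary using (¬_)

module Fp (p : ℕ) .{{_ : NonZero p}} where

  F : Set
  F = Fin p

  0F 1F : F
  0F = 0 mod p
  1F = 1 mod p

  infixl 6 _+F_
  infixl 7 _*F_

  _+F_ _*F_ : F → F → F
  x +F y = (toℕ x +ℕ toℕ y) mod p
  x *F y = (toℕ x *ℕ toℕ y) mod p

  -F_ : F → F
  -F x = (p ∸ toℕ x) mod p

  record M2 : Set where
    constructor mat
    field
      m11 m12 m21 m22 : F
  open M2 public

  _⊗_ : M2 → M2 → M2
  mat a b c d ⊗ mat e f g h =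
    mat (a *F e +F b *F g) (a *F f +F b *F h) (c *F e +F d *F g) (c *F f +F d *F h)

  I2 : M2
  I2 = mat 1F 0F 0F 1F

  scale : F → M2 → M2
  scale μ (mat a b c d) = mat (μ *F a) (μ *F b) (μ *F c) (μ *F d)

  -- V: coordinates (b , a , c) stand for
  --   b [[0,1],[0,0]] + a [[1,0],[0,-1]] + c [[0,0],[1,0]] = [[a , b],[c , -a]]
  V : Set
  V = F × F × F

  toM : V → M2
  toM (b , a , c) = mat a b c (-F a)

  scaleV : F → V → V
  scaleV μ (b , a , c) = (μ *F b , μ *F a , μ *F c)

  NonzeroV : V → Set
  NonzeroV v = v ≢ (0F , 0F , 0F)

  -- the c-coordinate (lower-left entry); a line is upper-triangular iff c = 0
  cCoord : V → F
  cCoord (_ , _ , c) = c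

  InB : M2 → Set
  InB g = (m21 g ≡ 0F) × (m22 g ≡ 1F) × (m11 g ≢ 0F)

  SameLine : V → V → Set
  SameLine v w = Σ F λ μ → (μ ≢ 0F) × (v ≡ scaleV μ w)

  -- for nonzero v, w: g·⟨v⟩ = ⟨w⟩ for some g ∈ B, where g acts by
  -- X ↦ g X g⁻¹ (h below is g⁻¹, i.e. g h = I)
  SameOrbit : V → V → Set
  SameOrbit v w = Σ M2 λ g → Σ M2 λ h → Σ F λ μ →
    InB g × (g ⊗ h ≡ I2) × (μ ≢ 0F) × ((g ⊗ toM v) ⊗ h ≡ scale μ (toM w))

  OrbitSize : V → ℕ → Set
  OrbitSize r k = Σ (List V) λ ws →
    (length ws ≡ k)
    × All (λ w → NonzeroV w × SameOrbit r w) ws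
    × AllPairs (λ w w′ → ¬ SameLine w w′) ws
    × (∀ w → NonzeroV w → SameOrbit r w → Any (SameLine w) ws)

  IsSquare : F → Set
  IsSquare n = Σ F λ t → t *F t ≡ n

  NonSquare : F → Set
  NonSquare n = (n ≢ 0F) × ¬ IsSquare n

-- Conjugation by g = [[x , y] , [0 , 1]] acts on the coordinates (b , a , c), up to the scalar x,
-- by (b , a , c) ↦ (x²b − 2xya − y²c , xa + yc , c), so two lines lie in one B-orbit exactly when one
-- is a multiple of such an image of the other. Whether c = 0 is invariant, and so is a² + bc = −det up
-- to nonzero squares; these two invariants separate the five orbits. A line with c = 0 is ⟨(1,0,0)⟩
-- or, after scaling a to 1, some ⟨(b,1,0)⟩. A line with c ≠ 0 is moved by the shear y = a/c to
-- ⟨(e,0,1)⟩, e = (a² + bc)/c², and then by x to ⟨(e x²,0,1)⟩; so, for a fixed non-square n, it lies in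
-- the orbit of ⟨(0,0,1)⟩, ⟨(1,0,1)⟩ or ⟨(n,0,1)⟩ according as e is 0, a nonzero square or a non-square.
-- For p = 2k + 1 the residues 1, …, k have pairwise distinct squares, exhausting the nonzero squares, so
-- the orbit of ⟨(d,0,1)⟩, d ≠ 0, consists of the k p distinct lines ⟨(d s² − a², a, 1)⟩ with
-- s ∈ {1, …, k}; for p ≥ 5, k p exceeds p.

module Submission where

open import Defs
open import Data.Nat using (ℕ; zero; suc; NonZero; _≤_; _<_; _*_; _∸_; _/_; z≤n; s≤s; _%_)
  renaming (_+_ to _+ℕ_)
import Data.Nat.Properties as ℕ
open import Data.Nat.DivMod using (_mod_; m%n<n; m<n⇒m%n≡m; %-distribˡ-+; %-distribˡ-*; n%n≡0; m*n/n≡m)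
open import Data.Nat.Tactic.RingSolver using (solve-∀)
open import Data.Nat.Divisibility using (_∣_; divides; m%n≡0⇒n∣m; ∣⇒≤)
open import Data.Nat.Primality using (Prime; euclidsLemma; prime⇒nonTrivial; prime⇒irreducible)
open import Data.Nat.Base using (nonTrivial⇒n>1)
open import Data.Integer as ℤ using (ℤ; +_; -[1+_])
import Data.Integer.Properties as ℤ
open import Data.Fin as Fin using (Fin; toℕ; punchOut)
open import Data.Fin.Properties as Fin
  using (toℕ-injective; toℕ-fromℕ<; toℕ<n; _≟_; any?; injective⇒≤; punchOut-injective; join-splitAt;
         remQuot-combine; combine-remQuot)
open import Data.Product using (_×_; _,_; Σ; ∃; proj₁; proj₂; uncurry)
open import Data.Sum as Sum using (_⊎_; inj₁; inj₂)
open import Data.Maybe as Maybe using (Maybe)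
open import Data.List using ([]; _∷_; tabulate; lookup)
open import Data.List.Relation.Unary.All using ([]; _∷_)
open import Data.List.Relation.Unary.AllPairs using (AllPairs; []; _∷_)
open import Data.List.Properties using (length-tabulate)
import Data.List.Relation.Unary.All.Properties as All
open import Data.List.Relation.Unary.Any using (Any; index)
import Data.List.Relation.Unary.Any.Properties as Any
import Data.List.Relation.Unary.AllPairs.Properties as AllPairs
open import Algebra.Bundles using (CommutativeRing)
open import Algebra.Structures using (IsCommutativeRing)
import Algebra.Consequences.Propositional as Consequences
import Algebra.Properties.Ring as RingProperties
import Algebra.Solver.Ring as RingSolver
import Algebra.Solver.Ring.AlmostCommutativeRing as AlmostCommutativeRing
open import Relation.Binary.PropositionalEquality
open import Function.Definitions using (Injective)
open import Function.Base using (_∘_; id)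
open import Relation.Nullary using (¬_; Dec; yes; no; contradiction)
open import Relation.Nullary.Decidable using (¬?; _×-dec_; decidable-stable; toSum; dec⇒maybe)

even⊎odd : ∀ n → (∃ λ k → n ≡ k +ℕ k) ⊎ (∃ λ k → n ≡ suc (k +ℕ k))
even⊎odd zero    = inj₁ (0 , refl)
even⊎odd (suc n) = Sum.[ (λ (k , n≡k+k) → inj₂ (k , cong suc n≡k+k))
                       , (λ (k , n≡1+k+k) → inj₁ (suc k , cong suc (trans n≡1+k+k (sym (ℕ.+-suc k k))))) ]′ (even⊎odd n)

odd-prime : ∀ {p} → Prime p → p ≢ 2 → ∃ λ k → p ≡ suc (k +ℕ k)
odd-prime {p} p-prime p≢2 = Sum.[ (λ even → contradiction even not-even) , id ]′ (even⊎odd p)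
  where
  not-even : ¬ (∃ λ k → p ≡ k +ℕ k)
  not-even (k , refl) = Sum.[ (λ ()) , (λ 2≡p → p≢2 (sym 2≡p)) ]′ (prime⇒irreducible p-prime 2∣k+k)
    where
    2∣k+k : 2 ∣ k +ℕ k
    2∣k+k = divides k (trans (cong (k +ℕ_) (sym (ℕ.+-identityʳ k))) (ℕ.*-comm 2 k))

injective⇒surjective : ∀ {n} {f : Fin n → Fin n} → Injective _≡_ _≡_ f → ∀ y → ∃ λ x → f x ≡ y
injective⇒surjective {suc n} {f} f-inj y with any? (λ x → f x ≟ y)
... | yes hit  = hit
... | no  miss = contradiction (injective⇒≤ punched-inj) ℕ.1+n≰n
  where
  misses : ∀ x → y ≢ f x
  misses x y≡fx = miss (x , sym y≡fx)
  punched-inj : Injective _≡_ _≡_ (λ x → punchOut (misses x))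
  punched-inj eq = f-inj (punchOut-injective (misses _) (misses _) eq)

module PrimeField (p-1 : ℕ) (p-prime : Prime (suc p-1)) where

  p : ℕ
  p = suc p-1

  open Fp p public

  toℕ-mod : ∀ m → toℕ (m mod p) ≡ m % p
  toℕ-mod m = toℕ-fromℕ< (m%n<n m p)

  mod-cong : ∀ m n → m % p ≡ n % p → m mod p ≡ n mod p
  mod-cong m n eq = toℕ-injective (trans (toℕ-mod m) (trans eq (sym (toℕ-mod n))))

  mod-toℕ : ∀ x → toℕ x mod p ≡ x
  mod-toℕ x = toℕ-injective (trans (toℕ-mod (toℕ x)) (m<n⇒m%n≡m (toℕ<n x)))

  mod-+ : ∀ m n → (m +ℕ n) mod p ≡ m mod p +F n mod p
  mod-+ m n = mod-cong (m +ℕ n) (toℕ (m mod p) +ℕ toℕ (n mod p)) (trans (%-distribˡ-+ m n p)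
    (cong₂ (λ a b → (a +ℕ b) % p) (sym (toℕ-mod m)) (sym (toℕ-mod n))))

  mod-* : ∀ m n → (m * n) mod p ≡ (m mod p) *F (n mod p)
  mod-* m n = mod-cong (m * n) (toℕ (m mod p) * toℕ (n mod p)) (trans (%-distribˡ-* m n p)
    (cong₂ (λ a b → (a * b) % p) (sym (toℕ-mod m)) (sym (toℕ-mod n))))

  1<p : 1 < p
  1<p = nonTrivial⇒n>1 p {{prime⇒nonTrivial p-prime}}

  toℕ-1F : toℕ 1F ≡ 1
  toℕ-1F = trans (toℕ-mod 1) (m<n⇒m%n≡m 1<p)

  module _ (x y z : F) where
    private
      a = toℕ x
      b = toℕ y
      c = toℕ z
    open ≡-Reasoning

    +F-assoc : (x +F y) +F z ≡ x +F (y +F z)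
    +F-assoc = begin
      (a +ℕ b) mod p +F z         ≡⟨ cong ((a +ℕ b) mod p +F_) (sym (mod-toℕ z)) ⟩
      (a +ℕ b) mod p +F c mod p   ≡⟨ sym (mod-+ (a +ℕ b) c) ⟩
      (a +ℕ b +ℕ c) mod p         ≡⟨ cong (_mod p) (ℕ.+-assoc a b c) ⟩
      (a +ℕ (b +ℕ c)) mod p       ≡⟨ mod-+ a (b +ℕ c) ⟩
      a mod p +F (y +F z)         ≡⟨ cong (_+F (y +F z)) (mod-toℕ x) ⟩
      x +F (y +F z)               ∎

    *F-assoc : (x *F y) *F z ≡ x *F (y *F z)
    *F-assoc = begin
      ((a * b) mod p) *F z          ≡⟨ cong ((a * b) mod p *F_) (sym (mod-toℕ z)) ⟩
      ((a * b) mod p) *F (c mod p)    ≡⟨ sym (mod-* (a * b) c) ⟩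
      (a * b * c) mod p           ≡⟨ cong (_mod p) (ℕ.*-assoc a b c) ⟩
      (a * (b * c)) mod p         ≡⟨ mod-* a (b * c) ⟩
      (a mod p) *F (y *F z)       ≡⟨ cong (_*F (y *F z)) (mod-toℕ x) ⟩
      x *F (y *F z)               ∎

    *F-distribˡ-+F : x *F (y +F z) ≡ x *F y +F x *F z
    *F-distribˡ-+F = begin
      x *F ((b +ℕ c) mod p)                ≡⟨ cong (_*F (y +F z)) (sym (mod-toℕ x)) ⟩
      (a mod p) *F ((b +ℕ c) mod p)           ≡⟨ sym (mod-* a (b +ℕ c)) ⟩
      (a * (b +ℕ c)) mod p                  ≡⟨ cong (_mod p) (ℕ.*-distribˡ-+ a b c) ⟩
      (a * b +ℕ a * c) mod p                ≡⟨ mod-+ (a * b) (a * c) ⟩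
      x *F y +F x *F z                      ∎

  +F-comm : ∀ x y → x +F y ≡ y +F x
  +F-comm x y = cong (_mod p) (ℕ.+-comm (toℕ x) (toℕ y))

  *F-comm : ∀ x y → x *F y ≡ y *F x
  *F-comm x y = cong (_mod p) (ℕ.*-comm (toℕ x) (toℕ y))

  +F-identityˡ : ∀ x → 0F +F x ≡ x
  +F-identityˡ = mod-toℕ

  *F-identityˡ : ∀ x → 1F *F x ≡ x
  *F-identityˡ x = trans (cong (λ n → (n * toℕ x) mod p) toℕ-1F)
                         (trans (cong (_mod p) (ℕ.*-identityˡ (toℕ x))) (mod-toℕ x))

  -F-inverseˡ : ∀ x → (-F x) +F x ≡ 0F
  -F-inverseˡ x = begin
      (p ∸ toℕ x) mod p +F x              ≡⟨ cong ((p ∸ toℕ x) mod p +F_) (sym (mod-toℕ x)) ⟩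
      (p ∸ toℕ x) mod p +F toℕ x mod p    ≡⟨ sym (mod-+ (p ∸ toℕ x) (toℕ x)) ⟩
      (p ∸ toℕ x +ℕ toℕ x) mod p          ≡⟨ cong (_mod p) (ℕ.m∸n+n≡m (ℕ.<⇒≤ (toℕ<n x))) ⟩
      p mod p                              ≡⟨ mod-cong p 0 (n%n≡0 p) ⟩
      0F                                   ∎
    where open ≡-Reasoning

  isCommutativeRing : IsCommutativeRing _≡_ _+F_ _*F_ -F_ 0F 1F
  isCommutativeRing = record
    { isRing = record
      { +-isAbelianGroup = record
        { isGroup = record
          { isMonoid = record
            { isSemigroup = record
              { isMagma = record { isEquivalence = isEquivalence ; ∙-cong = cong₂ _+F_ }
              ; assoc = +F-assoc }
            ; identity = comm∧idˡ⇒id +F-comm +F-identityˡ }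
          ; inverse = comm∧invˡ⇒inv +F-comm -F-inverseˡ
          ; ⁻¹-cong = cong -F_ }
        ; comm = +F-comm }
      ; *-cong = cong₂ _*F_
      ; *-assoc = *F-assoc
      ; *-identity = comm∧idˡ⇒id *F-comm *F-identityˡ
      ; distrib = *F-distribˡ-+F , comm∧distrˡ⇒distrʳ *F-comm *F-distribˡ-+F }
    ; *-comm = *F-comm }
    where open Consequences {A = F}

  commutativeRing : CommutativeRing _ _
  commutativeRing = record { isCommutativeRing = isCommutativeRing }

  open CommutativeRing commutativeRing public
    using (-‿inverseʳ; +-identityʳ; zeroʳ; zeroˡ; *-identityʳ; ring)
  open RingProperties ring public
    using (-0#≈0#; -‿distribˡ-*; -‿distribʳ-*; -‿involutive; -‿+-comm; +-cancelʳ)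

  -- The ring solver takes its coefficients from ℤ: constants of F itself, such as 1F = 1 mod p, do not
  -- compute for a variable p, so the solver could not normalise them.
  fromℤ : ℤ → F
  fromℤ (+ n)    = n mod p
  fromℤ -[1+ n ] = -F (suc n mod p)

  fromℤ-⊖ : ∀ m n → fromℤ (m ℤ.⊖ n) ≡ m mod p +F -F (n mod p)
  fromℤ-⊖ m       zero    = sym (trans (cong (m mod p +F_) -0#≈0#) (+-identityʳ (m mod p)))
  fromℤ-⊖ zero    (suc n) = sym (+F-identityˡ (-F (suc n mod p)))
  fromℤ-⊖ (suc m) (suc n) = begin
      fromℤ (suc m ℤ.⊖ suc n)                ≡⟨ cong fromℤ (ℤ.[1+m]⊖[1+n]≡m⊖n m n) ⟩
      fromℤ (m ℤ.⊖ n)                        ≡⟨ fromℤ-⊖ m n ⟩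
      a +F -F b                              ≡⟨ sym (+F-identityˡ (a +F -F b)) ⟩
      0F +F (a +F -F b)                      ≡⟨ cong (_+F (a +F -F b)) (sym (-‿inverseʳ 1F)) ⟩
      (1F +F -F 1F) +F (a +F -F b)           ≡⟨ +F-middleFour 1F (-F 1F) a (-F b) ⟩
      (1F +F a) +F (-F 1F +F -F b)           ≡⟨ cong ((1F +F a) +F_) (-‿+-comm 1F b) ⟩
      (1F +F a) +F -F (1F +F b)              ≡⟨ cong₂ (λ c d → c +F -F d) (sym (mod-+ 1 m)) (sym (mod-+ 1 n)) ⟩
      suc m mod p +F -F (suc n mod p)        ∎
    where open ≡-Reasoning
          a = m mod p
          b = n mod p
          +F-middleFour = Consequences.comm∧assoc⇒middleFour {A = F} +F-comm +F-assoc

  fromℤ-+ : ∀ i j → fromℤ (i ℤ.+ j) ≡ fromℤ i +F fromℤ j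
  fromℤ-+ (+ m)    (+ n)    = mod-+ m n
  fromℤ-+ (+ m)    -[1+ n ] = fromℤ-⊖ m (suc n)
  fromℤ-+ -[1+ m ] (+ n)    = trans (fromℤ-⊖ n (suc m)) (+F-comm (n mod p) (-F (suc m mod p)))
  fromℤ-+ -[1+ m ] -[1+ n ] = begin
    -F (suc (suc (m +ℕ n)) mod p)              ≡⟨ cong (λ k → -F (k mod p)) (sym (ℕ.+-suc (suc m) n)) ⟩
    -F ((suc m +ℕ suc n) mod p)                ≡⟨ cong -F_ (mod-+ (suc m) (suc n)) ⟩
    -F (suc m mod p +F suc n mod p)            ≡⟨ sym (-‿+-comm (suc m mod p) (suc n mod p)) ⟩
    -F (suc m mod p) +F -F (suc n mod p)       ∎
    where open ≡-Reasoning

  fromℤ-* : ∀ i j → fromℤ (i ℤ.* j) ≡ fromℤ i *F fromℤ j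
  fromℤ-* (+ m)     (+ n)     = trans (cong fromℤ (ℤ.+◃n≡+n (m * n))) (mod-* m n)
  fromℤ-* (+ zero)  -[1+ n ]  = sym (zeroˡ (fromℤ -[1+ n ]))
  fromℤ-* (+ suc m) -[1+ n ]  = trans (cong -F_ (mod-* (suc m) (suc n))) (-‿distribʳ-* (suc m mod p) (suc n mod p))
  fromℤ-* -[1+ m ]  (+ zero)  = trans (cong fromℤ (ℤ.*-zeroʳ -[1+ m ])) (sym (zeroʳ (fromℤ -[1+ m ])))
  fromℤ-* -[1+ m ]  (+ suc n) = trans (cong -F_ (mod-* (suc m) (suc n))) (-‿distribˡ-* (suc m mod p) (suc n mod p))
  fromℤ-* -[1+ m ]  -[1+ n ]  = begin
    (suc m * suc n) mod p                      ≡⟨ mod-* (suc m) (suc n) ⟩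
    a *F b                                     ≡⟨ sym (-‿involutive (a *F b)) ⟩
    -F (-F (a *F b))                           ≡⟨ cong -F_ (-‿distribˡ-* a b) ⟩
    -F (-F a *F b)                             ≡⟨ -‿distribʳ-* (-F a) b ⟩
    -F a *F -F b                               ∎
    where open ≡-Reasoning
          a = suc m mod p
          b = suc n mod p

  fromℤ-neg : ∀ i → fromℤ (ℤ.- i) ≡ -F fromℤ i
  fromℤ-neg (+ zero)  = sym -0#≈0#
  fromℤ-neg (+ suc n) = refl
  fromℤ-neg -[1+ n ]  = sym (-‿involutive _)

  fromℤ-homomorphism : CommutativeRing.rawRing ℤ.+-*-commutativeRing
                         AlmostCommutativeRing.-Raw-AlmostCommutative⟶
                       AlmostCommutativeRing.fromCommutativeRing commutativeRing
  fromℤ-homomorphism = record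
    { ⟦_⟧ = fromℤ ; +-homo = fromℤ-+ ; *-homo = fromℤ-* ; -‿homo = fromℤ-neg ; 0-homo = refl ; 1-homo = refl }

  fromℤ-≟ : ∀ i j → Maybe (fromℤ i ≡ fromℤ j)
  fromℤ-≟ i j = Maybe.map (cong fromℤ) (dec⇒maybe (i ℤ.≟ j))

  open RingSolver (CommutativeRing.rawRing ℤ.+-*-commutativeRing)
                  (AlmostCommutativeRing.fromCommutativeRing commutativeRing) fromℤ-homomorphism fromℤ-≟ public
    using (solve; _:=_; _:+_; _:*_; :-_; con)


  1F≢0F : 1F ≢ 0F
  1F≢0F eq = ℕ.1+n≢0 (trans (sym toℕ-1F) (cong toℕ eq))

  p∣toℕ⇒≡0F : ∀ z → p ∣ toℕ z → z ≡ 0F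
  p∣toℕ⇒≡0F z p∣z = toℕ-injective (below-p (toℕ z) (toℕ<n z) p∣z)
    where
    below-p : ∀ n → n < p → p ∣ n → n ≡ 0
    below-p zero    _   _   = refl
    below-p (suc n) n<p p∣n = contradiction (∣⇒≤ p∣n) (ℕ.<⇒≱ n<p)

  x*y≡0⇒x≡0∨y≡0 : ∀ x y → x *F y ≡ 0F → x ≡ 0F ⊎ y ≡ 0F
  x*y≡0⇒x≡0∨y≡0 x y xy≡0 =
    Sum.map (p∣toℕ⇒≡0F x) (p∣toℕ⇒≡0F y) (euclidsLemma (toℕ x) (toℕ y) p-prime p∣xy)
    where p∣xy = m%n≡0⇒n∣m (toℕ x * toℕ y) p (trans (sym (toℕ-mod (toℕ x * toℕ y))) (cong toℕ xy≡0))

  x≢0∧y≢0⇒x*y≢0 : ∀ {x y} → x ≢ 0F → y ≢ 0F → x *F y ≢ 0F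
  x≢0∧y≢0⇒x*y≢0 {x} {y} x≢0 y≢0 xy≡0 = Sum.[ x≢0 , y≢0 ] (x*y≡0⇒x≡0∨y≡0 x y xy≡0)

  x-y≡0⇒x≡y : ∀ x y → x +F -F y ≡ 0F → x ≡ y
  x-y≡0⇒x≡y x y x-y≡0 = begin
      x                    ≡⟨ solve 2 (λ x y → x := (x :+ :- y) :+ y) refl x y ⟩
      (x +F -F y) +F y     ≡⟨ cong (_+F y) x-y≡0 ⟩
      0F +F y              ≡⟨ +F-identityˡ y ⟩
      y                    ∎
    where open ≡-Reasoning

  *F-cancelˡ : ∀ {x} y z → x ≢ 0F → x *F y ≡ x *F z → y ≡ z
  *F-cancelˡ {x} y z x≢0 xy≡xz =
    x-y≡0⇒x≡y y z (Sum.[ (λ x≡0 → contradiction x≡0 x≢0) , id ]′ (x*y≡0⇒x≡0∨y≡0 x (y +F -F z) x[y-z]≡0))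
    where
    open ≡-Reasoning
    x[y-z]≡0 : x *F (y +F -F z) ≡ 0F
    x[y-z]≡0 = begin
      x *F (y +F -F z)          ≡⟨ solve 3 (λ x y z → x :* (y :+ :- z) := x :* y :+ :- (x :* z)) refl x y z ⟩
      x *F y +F -F (x *F z)     ≡⟨ cong (λ w → w +F -F (x *F z)) xy≡xz ⟩
      x *F z +F -F (x *F z)     ≡⟨ -‿inverseʳ (x *F z) ⟩
      0F                        ∎

  inverse : ∀ {x} → x ≢ 0F → ∃ λ y → x *F y ≡ 1F
  inverse x≢0 = injective⇒surjective (λ {y} {z} → *F-cancelˡ y z x≢0) 1F

  toℕ-neg : ∀ x → x ≢ 0F → toℕ (-F x) ≡ p ∸ toℕ x
  toℕ-neg x x≢0 with toℕ x in toℕx≡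
  ... | zero  = contradiction (toℕ-injective toℕx≡) x≢0
  ... | suc m = trans (toℕ-mod (p ∸ suc m)) (m<n⇒m%n≡m (s≤s (ℕ.m∸n≤m p-1 m)))

  -x≢0 : ∀ x → x ≢ 0F → -F x ≢ 0F
  -x≢0 x x≢0 -x≡0 = x≢0 (trans (sym (-‿involutive x)) (trans (cong -F_ -x≡0) -0#≈0#))

  square? : ∀ n → Dec (IsSquare n)
  square? n = any? (λ t → t *F t ≟ n)

  root≢0 : ∀ {s n} → s *F s ≡ n → n ≢ 0F → s ≢ 0F
  root≢0 {s} ss≡n n≢0 s≡0 = n≢0 (trans (sym ss≡n) (trans (cong (_*F s) s≡0) (zeroˡ s)))

  unit⇒≢0 : ∀ {x u} → x *F u ≡ 1F → u ≢ 0F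
  unit⇒≢0 {x} xu≡1 u≡0 = 1F≢0F (trans (sym xu≡1) (trans (cong (x *F_) u≡0) (zeroʳ x)))

  -- Polynomial identities that hold only modulo x u = 1 are proved by exhibiting the correction term.
  drop-[xu-1] : ∀ {x u} L R k → x *F u ≡ 1F → L ≡ R +F (x *F u +F -F 1F) *F k → L ≡ R
  drop-[xu-1] {x} {u} L R k xu≡1 L≡R+corr = begin
    L                                  ≡⟨ L≡R+corr ⟩
    R +F (x *F u +F -F 1F) *F k        ≡⟨ cong (λ w → R +F (w +F -F 1F) *F k) xu≡1 ⟩
    R +F (1F +F -F 1F) *F k            ≡⟨ solve 2 (λ R k → R :+ (con (+ 1) :+ :- con (+ 1)) :* k := R) refl R k ⟩
    R                                  ∎
    where open ≡-Reasoning

  *F-solveˡ : ∀ {x u z w} → x *F u ≡ 1F → x *F z ≡ w → z ≡ u *F w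
  *F-solveˡ {x} {u} {z} {w} xu≡1 xz≡w = begin
    z                  ≡⟨ drop-[xu-1] {x} {u} z (u *F (x *F z)) (-F z) xu≡1
                            (solve 3 (λ x u z → z := u :* (x :* z) :+ (x :* u :+ :- con (+ 1)) :* :- z) refl x u z) ⟩
    u *F (x *F z)      ≡⟨ cong (u *F_) xz≡w ⟩
    u *F w             ∎
    where open ≡-Reasoning

module Conjugation (p-1 : ℕ) (p-prime : Prime (suc p-1)) where

  open PrimeField p-1 p-prime public

  ≡-triple : ∀ {b a c b′ a′ c′ : F} → b ≡ b′ → a ≡ a′ → c ≡ c′ → (b , a , c) ≡ (b′ , a′ , c′)
  ≡-triple refl refl refl = refl

  ≡-mat : ∀ {a b c d a′ b′ c′ d′} → a ≡ a′ → b ≡ b′ → c ≡ c′ → d ≡ d′ → mat a b c d ≡ mat a′ b′ c′ d′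
  ≡-mat refl refl refl refl = refl

  scaleV-identity : ∀ v → scaleV 1F v ≡ v
  scaleV-identity (b , a , c) = ≡-triple (*F-identityˡ b) (*F-identityˡ a) (*F-identityˡ c)

  scaleV-* : ∀ μ ν v → scaleV μ (scaleV ν v) ≡ scaleV (μ *F ν) v
  scaleV-* μ ν (b , a , c) = ≡-triple (sym (*F-assoc μ ν b)) (sym (*F-assoc μ ν a)) (sym (*F-assoc μ ν c))

  sameLine-refl : ∀ v → SameLine v v
  sameLine-refl v = 1F , 1F≢0F , sym (scaleV-identity v)

  sameLine-sym : ∀ {v w} → SameLine v w → SameLine w v
  sameLine-sym {v} {w} (ν , ν≢0 , refl) = ν′ , unit⇒≢0 {ν} νν′≡1 , (begin
      w                          ≡⟨ sym (scaleV-identity w) ⟩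
      scaleV 1F w                ≡⟨ cong (λ κ → scaleV κ w) (trans (sym νν′≡1) (*F-comm ν ν′)) ⟩
      scaleV (ν′ *F ν) w         ≡⟨ sym (scaleV-* ν′ ν w) ⟩
      scaleV ν′ (scaleV ν w)     ∎)
    where
    open ≡-Reasoning
    ν′ = proj₁ (inverse ν≢0)
    νν′≡1 = proj₂ (inverse ν≢0)

  sameLine-trans : ∀ {u v w} → SameLine u v → SameLine v w → SameLine u w
  sameLine-trans {w = w} (μ , μ≢0 , refl) (ν , ν≢0 , refl) =
    μ *F ν , x≢0∧y≢0⇒x*y≢0 μ≢0 ν≢0 , scaleV-* μ ν w

  sameLine-scaleV : ∀ {ν} v → ν ≢ 0F → SameLine (scaleV ν v) v
  sameLine-scaleV v ν≢0 = _ , ν≢0 , refl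

  -- x · (g X g⁻¹) for g = [[x , y] , [0 , 1]] in the coordinates (b , a , c) of V;
  -- the factor x keeps it polynomial.
  act : F → F → V → V
  act x y (b , a , c) =
    (x *F x *F b +F -F (x *F y *F a +F x *F y *F a) +F -F (y *F y *F c) , x *F a +F y *F c , c)

  act-identity : ∀ v → act 1F 0F v ≡ v
  act-identity (b , a , c) = ≡-triple
    (solve 3 (λ b a c → con (+ 1) :* con (+ 1) :* b :+ :- (con (+ 1) :* con (+ 0) :* a :+ con (+ 1) :* con (+ 0) :* a)
                         :+ :- (con (+ 0) :* con (+ 0) :* c) := b) refl b a c)
    (solve 2 (λ a c → con (+ 1) :* a :+ con (+ 0) :* c := a) refl a c)
    refl

  act-scaleV : ∀ x y ν v → act x y (scaleV ν v) ≡ scaleV ν (act x y v)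
  act-scaleV x y ν (b , a , c) = ≡-triple
    (solve 6 (λ x y ν b a c → x :* x :* (ν :* b) :+ :- (x :* y :* (ν :* a) :+ x :* y :* (ν :* a)) :+ :- (y :* y :* (ν :* c))
                            := ν :* (x :* x :* b :+ :- (x :* y :* a :+ x :* y :* a) :+ :- (y :* y :* c))) refl x y ν b a c)
    (solve 5 (λ x y ν a c → x :* (ν :* a) :+ y :* (ν :* c) := ν :* (x :* a :+ y :* c)) refl x y ν a c)
    refl

  act-act : ∀ x y x′ y′ v → act x y (act x′ y′ v) ≡ act (x *F x′) (x *F y′ +F y) v
  act-act x y x′ y′ (b , a , c) = ≡-triple
    (solve 7 (λ x y x′ y′ b a c →
        x :* x :* (x′ :* x′ :* b :+ :- (x′ :* y′ :* a :+ x′ :* y′ :* a) :+ :- (y′ :* y′ :* c))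
          :+ :- (x :* y :* (x′ :* a :+ y′ :* c) :+ x :* y :* (x′ :* a :+ y′ :* c)) :+ :- (y :* y :* c)
        := x :* x′ :* (x :* x′) :* b :+ :- (x :* x′ :* (x :* y′ :+ y) :* a :+ x :* x′ :* (x :* y′ :+ y) :* a)
          :+ :- ((x :* y′ :+ y) :* (x :* y′ :+ y) :* c)) refl x y x′ y′ b a c)
    (solve 6 (λ x y x′ y′ a c → x :* (x′ :* a :+ y′ :* c) :+ y :* c := x :* x′ :* a :+ (x :* y′ :+ y) :* c)
       refl x y x′ y′ a c)
    refl

  act-inverse : ∀ x y u v → x *F u ≡ 1F → act u (-F (y *F u)) (act x y v) ≡ v
  act-inverse x y u v xu≡1 = begin
    act u (-F (y *F u)) (act x y v)                 ≡⟨ act-act u (-F (y *F u)) x y v ⟩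
    act (u *F x) (u *F y +F -F (y *F u)) v          ≡⟨ cong₂ (λ s t → act s t v) (trans (*F-comm u x) xu≡1)
                                                         (solve 2 (λ u y → u :* y :+ :- (y :* u) := con (+ 0)) refl u y) ⟩
    act 1F 0F v                                     ≡⟨ act-identity v ⟩
    v                                               ∎
    where open ≡-Reasoning

  sameLine-act : ∀ x y {v w} → SameLine v w → SameLine (act x y v) (act x y w)
  sameLine-act x y {w = w} (ν , ν≢0 , refl) = ν , ν≢0 , act-scaleV x y ν w

  B-inverse : ∀ x y u → x *F u ≡ 1F → mat x y 0F 1F ⊗ mat u (-F (y *F u)) 0F 1F ≡ I2
  B-inverse x y u xu≡1 = ≡-mat
    (trans (solve 3 (λ x y u → x :* u :+ y :* con (+ 0) := x :* u) refl x y u) xu≡1)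
    (drop-[xu-1] {x} {u} _ 0F (-F y) xu≡1
       (solve 3 (λ x y u → x :* :- (y :* u) :+ y :* con (+ 1)
                           := con (+ 0) :+ (x :* u :+ :- con (+ 1)) :* :- y) refl x y u))
    (solve 1 (λ u → con (+ 0) :* u :+ con (+ 1) :* con (+ 0) := con (+ 0)) refl u)
    (solve 2 (λ y u → con (+ 0) :* :- (y :* u) :+ con (+ 1) :* con (+ 1) := con (+ 1)) refl y u)

  inverse-in-B : ∀ x y h → mat x y 0F 1F ⊗ h ≡ I2 → ∃ λ u → x *F u ≡ 1F × h ≡ mat u (-F (y *F u)) 0F 1F
  inverse-in-B x y (mat h₁₁ h₁₂ h₂₁ h₂₂) gh≡I = h₁₁ , xh₁₁≡1 , ≡-mat refl h₁₂≡-yh₁₁ h₂₁≡0 h₂₂≡1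
    where
    open ≡-Reasoning
    h₂₁≡0 : h₂₁ ≡ 0F
    h₂₁≡0 = trans (solve 2 (λ h₁₁ h₂₁ → h₂₁ := con (+ 0) :* h₁₁ :+ con (+ 1) :* h₂₁) refl h₁₁ h₂₁)
                  (cong m21 gh≡I)
    h₂₂≡1 : h₂₂ ≡ 1F
    h₂₂≡1 = trans (solve 2 (λ h₁₂ h₂₂ → h₂₂ := con (+ 0) :* h₁₂ :+ con (+ 1) :* h₂₂) refl h₁₂ h₂₂)
                  (cong m22 gh≡I)
    xh₁₁≡1 : x *F h₁₁ ≡ 1F
    xh₁₁≡1 = begin
      x *F h₁₁                   ≡⟨ solve 2 (λ x h₁₁ → x :* h₁₁ := x :* h₁₁ :+ con (+ 0)) refl x h₁₁ ⟩
      x *F h₁₁ +F 0F             ≡⟨ cong (x *F h₁₁ +F_) (trans (sym (zeroʳ y)) (cong (y *F_) (sym h₂₁≡0))) ⟩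
      x *F h₁₁ +F y *F h₂₁       ≡⟨ cong m11 gh≡I ⟩
      1F                         ∎
    xh₁₂+y≡0 : x *F h₁₂ +F y *F 1F ≡ 0F
    xh₁₂+y≡0 = subst (λ w → x *F h₁₂ +F y *F w ≡ 0F) h₂₂≡1 (cong m12 gh≡I)
    h₁₂≡-yh₁₁ : h₁₂ ≡ -F (y *F h₁₁)
    h₁₂≡-yh₁₁ = begin
      h₁₂                                         ≡⟨ drop-[xu-1] {x} {h₁₁} _ _ (-F h₁₂) xh₁₁≡1
           (solve 4 (λ x y h₁₁ h₁₂ → h₁₂ := :- (y :* h₁₁) :+ h₁₁ :* (x :* h₁₂ :+ y :* con (+ 1))
                                          :+ (x :* h₁₁ :+ :- con (+ 1)) :* :- h₁₂) refl x y h₁₁ h₁₂) ⟩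
      -F (y *F h₁₁) +F h₁₁ *F (x *F h₁₂ +F y *F 1F) ≡⟨ cong (λ w → -F (y *F h₁₁) +F h₁₁ *F w) xh₁₂+y≡0 ⟩
      -F (y *F h₁₁) +F h₁₁ *F 0F                  ≡⟨ solve 2 (λ y h₁₁ → :- (y :* h₁₁) :+ h₁₁ :* con (+ 0)
                                                                       := :- (y :* h₁₁)) refl y h₁₁ ⟩
      -F (y *F h₁₁)                               ∎

  conjugate : ∀ x y u v → x *F u ≡ 1F →
              (mat x y 0F 1F ⊗ toM v) ⊗ mat u (-F (y *F u)) 0F 1F ≡ scale u (toM (act x y v))
  conjugate x y u (b , a , c) xu≡1 = ≡-mat
    (solve 6 (λ x y u b a c → (x :* a :+ y :* c) :* u :+ (x :* b :+ y :* :- a) :* con (+ 0) := u :* (x :* a :+ y :* c))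
       refl x y u b a c)
    (drop-[xu-1] {x} {u} _ _ (y *F a +F -F (x *F b)) xu≡1
       (solve 6 (λ x y u b a c → (x :* a :+ y :* c) :* :- (y :* u) :+ (x :* b :+ y :* :- a) :* con (+ 1)
                  := u :* (x :* x :* b :+ :- (x :* y :* a :+ x :* y :* a) :+ :- (y :* y :* c))
                     :+ (x :* u :+ :- con (+ 1)) :* (y :* a :+ :- (x :* b))) refl x y u b a c))
    (solve 6 (λ x y u b a c → (con (+ 0) :* a :+ con (+ 1) :* c) :* u :+ (con (+ 0) :* b :+ con (+ 1) :* :- a) :* con (+ 0)
                := u :* c) refl x y u b a c)
    (drop-[xu-1] {x} {u} _ _ a xu≡1
       (solve 6 (λ x y u b a c → (con (+ 0) :* a :+ con (+ 1) :* c) :* :- (y :* u) :+ (con (+ 0) :* b :+ con (+ 1) :* :- a) :* con (+ 1)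
                  := u :* :- (x :* a :+ y :* c) :+ (x :* u :+ :- con (+ 1)) :* a) refl x y u b a c))

  toM-scaleV : ∀ ν v → toM (scaleV ν v) ≡ scale ν (toM v)
  toM-scaleV ν (b , a , c) = ≡-mat refl refl refl (-‿distribʳ-* ν a)

  scale-* : ∀ μ ν M → scale μ (scale ν M) ≡ scale (μ *F ν) M
  scale-* μ ν (mat a b c d) =
    ≡-mat (sym (*F-assoc μ ν a)) (sym (*F-assoc μ ν b)) (sym (*F-assoc μ ν c)) (sym (*F-assoc μ ν d))

  scale-toM-cancel : ∀ {u μ} v w → u ≢ 0F → μ ≢ 0F → scale u (toM v) ≡ scale μ (toM w) → SameLine w v
  scale-toM-cancel {u} {μ} (b , a , c) (b′ , a′ , c′) u≢0 μ≢0 eq =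
    μ′ *F u , x≢0∧y≢0⇒x*y≢0 (unit⇒≢0 {μ} μμ′≡1) u≢0 ,
    ≡-triple (divide b b′ (cong m12 eq)) (divide a a′ (cong m11 eq)) (divide c c′ (cong m21 eq))
    where
    μ′ = proj₁ (inverse μ≢0)
    μμ′≡1 = proj₂ (inverse μ≢0)
    divide : ∀ z z′ → u *F z ≡ μ *F z′ → z′ ≡ (μ′ *F u) *F z
    divide z z′ uz≡μz′ = trans (*F-solveˡ {μ} μμ′≡1 (sym uz≡μz′)) (sym (*F-assoc μ′ u z))

  sameOrbit⇒act : ∀ {v w} → SameOrbit v w → ∃ λ x → ∃ λ y → x ≢ 0F × SameLine w (act x y v)
  sameOrbit⇒act {v} {w} (mat x y _ _ , h , μ , (refl , refl , x≢0) , gh≡I , μ≢0 , conj≡μw) =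
    x , y , x≢0 , scale-toM-cancel (act x y v) w (unit⇒≢0 {x} xu≡1) μ≢0
                    (trans (sym (conjugate x y u v xu≡1)) (subst Conjugates h≡ conj≡μw))
    where
    Conjugates : M2 → Set
    Conjugates h′ = (mat x y 0F 1F ⊗ toM v) ⊗ h′ ≡ scale μ (toM w)
    u = proj₁ (inverse-in-B x y h gh≡I)
    xu≡1 = proj₁ (proj₂ (inverse-in-B x y h gh≡I))
    h≡ = proj₂ (proj₂ (inverse-in-B x y h gh≡I))

  act⇒sameOrbit : ∀ {x y v w} → x ≢ 0F → SameLine w (act x y v) → SameOrbit v w
  act⇒sameOrbit {x} {y} {v} {w} x≢0 w∼xv =
    mat x y 0F 1F , mat u (-F (y *F u)) 0F 1F , u *F κ , (refl , refl , x≢0) , B-inverse x y u xu≡1 ,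
    x≢0∧y≢0⇒x*y≢0 (unit⇒≢0 {x} xu≡1) κ≢0 , (begin
      (mat x y 0F 1F ⊗ toM v) ⊗ mat u (-F (y *F u)) 0F 1F    ≡⟨ conjugate x y u v xu≡1 ⟩
      scale u (toM (act x y v))                              ≡⟨ cong (scale u ∘ toM) xv≡κw ⟩
      scale u (toM (scaleV κ w))                             ≡⟨ cong (scale u) (toM-scaleV κ w) ⟩
      scale u (scale κ (toM w))                              ≡⟨ scale-* u κ (toM w) ⟩
      scale (u *F κ) (toM w)                                 ∎)
    where
    open ≡-Reasoning
    u = proj₁ (inverse x≢0)
    xu≡1 = proj₂ (inverse x≢0)
    κ = proj₁ (sameLine-sym w∼xv)
    κ≢0 = proj₁ (proj₂ (sameLine-sym w∼xv))
    xv≡κw = proj₂ (proj₂ (sameLine-sym w∼xv))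

  sameOrbit-refl : ∀ v → SameOrbit v v
  sameOrbit-refl v = act⇒sameOrbit 1F≢0F (subst (SameLine v) (sym (act-identity v)) (sameLine-refl v))

  sameOrbit-sym : ∀ {v w} → SameOrbit v w → SameOrbit w v
  sameOrbit-sym {v} {w} v∼w =
    let (x , y , x≢0 , w∼xv) = sameOrbit⇒act v∼w
        (u , xu≡1) = inverse x≢0
    in act⇒sameOrbit (unit⇒≢0 {x} xu≡1)
         (sameLine-sym (subst (SameLine (act u (-F (y *F u)) w)) (act-inverse x y u v xu≡1)
                              (sameLine-act u (-F (y *F u)) w∼xv)))

  sameOrbit-trans : ∀ {u v w} → SameOrbit u v → SameOrbit v w → SameOrbit u w
  sameOrbit-trans {u} {v} {w} u∼v v∼w =
    let (x , y , x≢0 , v∼xu) = sameOrbit⇒act u∼v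
        (x′ , y′ , x′≢0 , w∼x′v) = sameOrbit⇒act v∼w
    in act⇒sameOrbit (x≢0∧y≢0⇒x*y≢0 x′≢0 x≢0)
         (sameLine-trans w∼x′v (subst (SameLine (act x′ y′ v)) (act-act x′ y′ x y u) (sameLine-act x′ y′ v∼xu)))

  sameOrbit-sameLine : ∀ {u v w} → SameOrbit u v → SameLine w v → SameOrbit u w
  sameOrbit-sameLine u∼v w∼v =
    let (_ , _ , x≢0 , v∼xu) = sameOrbit⇒act u∼v in act⇒sameOrbit x≢0 (sameLine-trans w∼v v∼xu)

  -- disc v = − det (toM v); conjugation preserves it, so it is a quadratic invariant of lines up to squares.
  disc : V → F
  disc (b , a , c) = a *F a +F b *F c

  disc-act : ∀ x y v → disc (act x y v) ≡ x *F x *F disc v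
  disc-act x y (b , a , c) = solve 5 (λ x y b a c →
    (x :* a :+ y :* c) :* (x :* a :+ y :* c) :+ (x :* x :* b :+ :- (x :* y :* a :+ x :* y :* a) :+ :- (y :* y :* c)) :* c
    := x :* x :* (a :* a :+ b :* c)) refl x y b a c

  disc-scaleV : ∀ ν v → disc (scaleV ν v) ≡ ν *F ν *F disc v
  disc-scaleV ν (b , a , c) = solve 4 (λ ν b a c →
    ν :* a :* (ν :* a) :+ ν :* b :* (ν :* c) := ν :* ν :* (a :* a :+ b :* c)) refl ν b a c

  sameOrbit-disc : ∀ {v w} → SameOrbit v w → ∃ λ t → t ≢ 0F × disc w ≡ t *F t *F disc v
  sameOrbit-disc {v} {w} v∼w =
    let (x , y , x≢0 , (ν , ν≢0 , w≡νxv)) = sameOrbit⇒act v∼w in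
    ν *F x , x≢0∧y≢0⇒x*y≢0 ν≢0 x≢0 , (begin
      disc w                             ≡⟨ cong disc w≡νxv ⟩
      disc (scaleV ν (act x y v))        ≡⟨ disc-scaleV ν (act x y v) ⟩
      ν *F ν *F disc (act x y v)         ≡⟨ cong (ν *F ν *F_) (disc-act x y v) ⟩
      ν *F ν *F (x *F x *F disc v)       ≡⟨ solve 3 (λ ν x d → ν :* ν :* (x :* x :* d) := ν :* x :* (ν :* x) :* d)
                                                     refl ν x (disc v) ⟩
      ν *F x *F (ν *F x) *F disc v       ∎)
    where open ≡-Reasoning

  sameOrbit-cCoord≡0 : ∀ {v w} → SameOrbit v w → cCoord v ≡ 0F → cCoord w ≡ 0F
  sameOrbit-cCoord≡0 {_ , _ , c} v∼w c≡0 =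
    let (_ , _ , _ , (ν , _ , w≡νxv)) = sameOrbit⇒act v∼w in
    trans (cong cCoord w≡νxv) (trans (cong (ν *F_) c≡0) (zeroʳ ν))

  ¬sameOrbit-cCoord : ∀ {v w} → cCoord v ≡ 0F → cCoord w ≢ 0F → ¬ SameOrbit v w
  ¬sameOrbit-cCoord cv≡0 cw≢0 v∼w = cw≢0 (sameOrbit-cCoord≡0 v∼w cv≡0)

  ¬sameOrbit-disc : ∀ {v w} → disc v ≡ 0F → disc w ≢ 0F → ¬ SameOrbit v w
  ¬sameOrbit-disc {v} dv≡0 dw≢0 v∼w =
    let (t , _ , dw≡ttdv) = sameOrbit-disc v∼w in
    dw≢0 (trans dw≡ttdv (trans (cong (t *F t *F_) dv≡0) (zeroʳ (t *F t))))

  disc-[b,0,1] : ∀ b → disc (b , 0F , 1F) ≡ b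
  disc-[b,0,1] = solve 1 (λ b → con (+ 0) :* con (+ 0) :+ b :* con (+ 1) := b) refl

  orbitSize-tabulate : ∀ {m} r (f : Fin m → V) →
    (∀ i → NonzeroV (f i) × SameOrbit r (f i)) → (∀ {i j} → SameLine (f i) (f j) → i ≡ j) →
    (∀ w → NonzeroV w → SameOrbit r w → ∃ λ i → SameLine w (f i)) → OrbitSize r m
  orbitSize-tabulate r f f-in-orbit f-distinct f-covers =
    tabulate f , length-tabulate f , All.tabulate⁺ f-in-orbit ,
    AllPairs.tabulate⁺ (λ i≢j fi∼fj → i≢j (f-distinct fi∼fj)) ,
    λ w w≢0 r∼w → let (i , w∼fi) = f-covers w w≢0 r∼w in Any.tabulate⁺ i w∼fi

  distinctLines≤orbitSize : ∀ {m n} r (f : Fin m → V) → OrbitSize r n →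
    (∀ i → NonzeroV (f i) × SameOrbit r (f i)) → (∀ {i j} → SameLine (f i) (f j) → i ≡ j) → m ≤ n
  distinctLines≤orbitSize r f (ws , refl , _ , _ , covers) f-in-orbit f-distinct = injective⇒≤ position-injective
    where
    position : ∀ i → Any (SameLine (f i)) ws
    position i = covers (f i) (proj₁ (f-in-orbit i)) (proj₂ (f-in-orbit i))
    position-injective : Injective _≡_ _≡_ (index ∘ position)
    position-injective {i} {j} same-index = f-distinct (sameLine-trans
      (subst (λ k → SameLine (f i) (lookup ws k)) same-index (Any.lookup-index (position i)))
      (sameLine-sym (Any.lookup-index (position j))))

  nonzero-b≡1 : ∀ {a c} → NonzeroV (1F , a , c)
  nonzero-b≡1 eq = 1F≢0F (cong proj₁ eq)

  nonzero-a≡1 : ∀ {b c} → NonzeroV (b , 1F , c)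
  nonzero-a≡1 eq = 1F≢0F (cong (proj₁ ∘ proj₂) eq)

  nonzero-c≡1 : ∀ {b a} → NonzeroV (b , a , 1F)
  nonzero-c≡1 eq = 1F≢0F (cong (proj₂ ∘ proj₂) eq)

  scaleV-fixing-1 : ∀ {μ} w → 1F ≡ μ *F 1F → scaleV μ w ≡ w
  scaleV-fixing-1 {μ} w 1≡μ = trans (cong (λ κ → scaleV κ w) (trans (sym (*-identityʳ μ)) (sym 1≡μ))) (scaleV-identity w)

  sameLine-a≡1 : ∀ {b c b′ c′} → SameLine (b , 1F , c) (b′ , 1F , c′) → (b , 1F , c) ≡ (b′ , 1F , c′)
  sameLine-a≡1 (μ , _ , eq) = trans eq (scaleV-fixing-1 {μ} _ (cong (proj₁ ∘ proj₂) eq))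

  sameLine-c≡1 : ∀ {b a b′ a′} → SameLine (b , a , 1F) (b′ , a′ , 1F) → (b , a , 1F) ≡ (b′ , a′ , 1F)
  sameLine-c≡1 (μ , _ , eq) = trans eq (scaleV-fixing-1 {μ} _ (cong (proj₂ ∘ proj₂) eq))

  act-[1,0,0] : ∀ x y → act x y (1F , 0F , 0F) ≡ scaleV (x *F x) (1F , 0F , 0F)
  act-[1,0,0] x y = ≡-triple
    (solve 2 (λ x y → x :* x :* con (+ 1) :+ :- (x :* y :* con (+ 0) :+ x :* y :* con (+ 0)) :+ :- (y :* y :* con (+ 0))
                     := x :* x :* con (+ 1)) refl x y)
    (solve 2 (λ x y → x :* con (+ 0) :+ y :* con (+ 0) := x :* x :* con (+ 0)) refl x y)
    (sym (zeroʳ (x *F x)))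

  act-[0,1,0] : ∀ x y → act x y (0F , 1F , 0F) ≡ scaleV x (-F (y +F y) , 1F , 0F)
  act-[0,1,0] x y = ≡-triple
    (solve 2 (λ x y → x :* x :* con (+ 0) :+ :- (x :* y :* con (+ 1) :+ x :* y :* con (+ 1)) :+ :- (y :* y :* con (+ 0))
                     := x :* :- (y :+ y)) refl x y)
    (solve 2 (λ x y → x :* con (+ 1) :+ y :* con (+ 0) := x :* con (+ 1)) refl x y)
    (sym (zeroʳ x))

  act-[d,0,1] : ∀ x y d → act x y (d , 0F , 1F) ≡ (x *F x *F d +F -F (y *F y) , y , 1F)
  act-[d,0,1] x y d = ≡-triple
    (solve 3 (λ x y d → x :* x :* d :+ :- (x :* y :* con (+ 0) :+ x :* y :* con (+ 0)) :+ :- (y :* y :* con (+ 1))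
                       := x :* x :* d :+ :- (y :* y)) refl x y d)
    (solve 2 (λ x y → x :* con (+ 0) :+ y :* con (+ 1) := y) refl x y)
    refl

  sameOrbit-[1,0,0]⇒sameLine : ∀ {v} → SameOrbit (1F , 0F , 0F) v → SameLine v (1F , 0F , 0F)
  sameOrbit-[1,0,0]⇒sameLine r∼v =
    let (x , y , x≢0 , v∼xr) = sameOrbit⇒act r∼v in sameLine-trans v∼xr
      (subst (λ z → SameLine z (1F , 0F , 0F)) (sym (act-[1,0,0] x y)) (sameLine-scaleV _ (x≢0∧y≢0⇒x*y≢0 x≢0 x≢0)))

  orbitSize-[1,0,0] : OrbitSize (1F , 0F , 0F) 1
  orbitSize-[1,0,0] = orbitSize-tabulate _ (λ _ → (1F , 0F , 0F)) (λ _ → nonzero-b≡1 , sameOrbit-refl _)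
    (λ { {Fin.zero} {Fin.zero} _ → refl ; {Fin.suc ()} ; {j = Fin.suc ()} })
    (λ _ _ r∼w → Fin.zero , sameOrbit-[1,0,0]⇒sameLine r∼w)

  upperLine : F → V
  upperLine b = (b , 1F , 0F)

  sameOrbit-[0,1,0]⇒upperLine : ∀ {v} → SameOrbit (0F , 1F , 0F) v → ∃ λ b → SameLine v (upperLine b)
  sameOrbit-[0,1,0]⇒upperLine r∼v =
    let (x , y , x≢0 , v∼xr) = sameOrbit⇒act r∼v in -F (y +F y) , sameLine-trans v∼xr
      (subst (λ z → SameLine z (upperLine (-F (y +F y)))) (sym (act-[0,1,0] x y)) (sameLine-scaleV _ x≢0))

  sameOrbit-[0,1,0]-upperLine : 1F +F 1F ≢ 0F → ∀ b → SameOrbit (0F , 1F , 0F) (upperLine b)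
  sameOrbit-[0,1,0]-upperLine 2≢0 b =
    act⇒sameOrbit 1F≢0F (subst (SameLine (upperLine b)) (sym act≡) (sameLine-refl _))
    where
    h = proj₁ (inverse 2≢0)
    2h≡1 = proj₂ (inverse 2≢0)
    act≡ : act 1F (-F (b *F h)) (0F , 1F , 0F) ≡ upperLine b
    act≡ = ≡-triple
      (drop-[xu-1] {1F +F 1F} {h} _ _ b 2h≡1 (solve 2 (λ b h →
         con (+ 1) :* con (+ 1) :* con (+ 0) :+ :- (con (+ 1) :* :- (b :* h) :* con (+ 1) :+ con (+ 1) :* :- (b :* h) :* con (+ 1))
           :+ :- (:- (b :* h) :* :- (b :* h) :* con (+ 0))
         := b :+ ((con (+ 1) :+ con (+ 1)) :* h :+ :- con (+ 1)) :* b) refl b h))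
      (solve 1 (λ y → con (+ 1) :* con (+ 1) :+ y :* con (+ 0) := con (+ 1)) refl (-F (b *F h)))
      refl

  orbitSize-[0,1,0] : 1F +F 1F ≢ 0F → OrbitSize (0F , 1F , 0F) p
  orbitSize-[0,1,0] 2≢0 = orbitSize-tabulate _ upperLine (λ b → nonzero-a≡1 , sameOrbit-[0,1,0]-upperLine 2≢0 b)
    (λ b∼b′ → cong proj₁ (sameLine-a≡1 b∼b′)) (λ _ _ → sameOrbit-[0,1,0]⇒upperLine)

  nilpotentLine : F → V
  nilpotentLine a = (-F (a *F a) , a , 1F)

  act-[0,0,1] : ∀ x y → act x y (0F , 0F , 1F) ≡ nilpotentLine y
  act-[0,0,1] x y = trans (act-[d,0,1] x y 0F)
    (cong (_, y , 1F) (solve 2 (λ x y → x :* x :* con (+ 0) :+ :- (y :* y) := :- (y :* y)) refl x y))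

  sameOrbit-[0,0,1]⇒nilpotentLine : ∀ {v} → SameOrbit (0F , 0F , 1F) v → ∃ λ a → SameLine v (nilpotentLine a)
  sameOrbit-[0,0,1]⇒nilpotentLine {v} r∼v =
    let (x , y , _ , v∼xr) = sameOrbit⇒act r∼v in y , subst (SameLine v) (act-[0,0,1] x y) v∼xr

  sameOrbit-[0,0,1]-nilpotentLine : ∀ a → SameOrbit (0F , 0F , 1F) (nilpotentLine a)
  sameOrbit-[0,0,1]-nilpotentLine a =
    act⇒sameOrbit 1F≢0F (subst (SameLine (nilpotentLine a)) (sym (act-[0,0,1] 1F a)) (sameLine-refl _))

  orbitSize-[0,0,1] : OrbitSize (0F , 0F , 1F) p
  orbitSize-[0,0,1] = orbitSize-tabulate _ nilpotentLine (λ a → nonzero-c≡1 , sameOrbit-[0,0,1]-nilpotentLine a)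
    (λ a∼a′ → cong (proj₁ ∘ proj₂) (sameLine-c≡1 a∼a′)) (λ _ _ → sameOrbit-[0,0,1]⇒nilpotentLine)

  sameOrbit-[d,0,1]-square : ∀ {d d′} s → s ≢ 0F → s *F s *F d ≡ d′ → SameOrbit (d , 0F , 1F) (d′ , 0F , 1F)
  sameOrbit-[d,0,1]-square {d} {d′} s s≢0 ssd≡d′ =
    act⇒sameOrbit s≢0 (subst (SameLine (d′ , 0F , 1F)) (sym act≡) (sameLine-refl _))
    where
    act≡ : act s 0F (d , 0F , 1F) ≡ (d′ , 0F , 1F)
    act≡ = trans (act-[d,0,1] s 0F d)
      (cong (_, 0F , 1F) (trans (solve 2 (λ s d → s :* s :* d :+ :- (con (+ 0) :* con (+ 0)) := s :* s :* d) refl s d) ssd≡d′))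

  -- The shear y = a c⁻¹ moves the a-coordinate of a line with c ≠ 0 to 0.
  sameOrbit-normalForm : ∀ v → cCoord v ≢ 0F → ∃ λ e → SameOrbit (e , 0F , 1F) v
  sameOrbit-normalForm (b , a , c) c≢0 = e , act⇒sameOrbit 1F≢0F (c , c≢0 , ≡-triple b≡ a≡ c≡)
    where
    c′ = proj₁ (inverse c≢0)
    cc′≡1 = proj₂ (inverse c≢0)
    e = (a *F a +F b *F c) *F (c′ *F c′)
    shear = act 1F (a *F c′) (e , 0F , 1F)
    b≡ : b ≡ c *F proj₁ shear
    b≡ = drop-[xu-1] {c} {c′} _ _ (-F (b *F (c *F c′ +F 1F))) cc′≡1 (solve 4 (λ b a c c′ →
      b := c :* (con (+ 1) :* con (+ 1) :* ((a :* a :+ b :* c) :* (c′ :* c′))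
                  :+ :- (con (+ 1) :* (a :* c′) :* con (+ 0) :+ con (+ 1) :* (a :* c′) :* con (+ 0))
                  :+ :- (a :* c′ :* (a :* c′) :* con (+ 1)))
           :+ (c :* c′ :+ :- con (+ 1)) :* :- (b :* (c :* c′ :+ con (+ 1)))) refl b a c c′)
    a≡ : a ≡ c *F proj₁ (proj₂ shear)
    a≡ = drop-[xu-1] {c} {c′} _ _ (-F a) cc′≡1 (solve 3 (λ a c c′ →
      a := c :* (con (+ 1) :* con (+ 0) :+ a :* c′ :* con (+ 1)) :+ (c :* c′ :+ :- con (+ 1)) :* :- a) refl a c c′)
    c≡ : c ≡ c *F proj₂ (proj₂ shear)
    c≡ = sym (*-identityʳ c)

-- The conclusion of lemma6p7, named so that it can be transported along p ≡ 2k + 1.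
OrbitClassification : (p : ℕ) .{{_ : NonZero p}} → Set
OrbitClassification p =
    let open Fp p in
    (Σ F NonSquare)
    × (∀ v → NonzeroV v → ((SameOrbit (1F , 0F , 0F) v → SameLine v (1F , 0F , 0F))
                          × (SameLine v (1F , 0F , 0F) → SameOrbit (1F , 0F , 0F) v)))
    × OrbitSize (1F , 0F , 0F) 1
    × (∀ v → NonzeroV v → ((SameOrbit (0F , 1F , 0F) v → Σ F λ b → SameLine v (b , 1F , 0F))
                          × ((Σ F λ b → SameLine v (b , 1F , 0F)) → SameOrbit (0F , 1F , 0F) v)))
    × OrbitSize (0F , 1F , 0F) p
    × (∀ v → NonzeroV v → ((SameOrbit (0F , 0F , 1F) v → Σ F λ a → SameLine v (-F (a *F a) , a , 1F))
                          × ((Σ F λ a → SameLine v (-F (a *F a) , a , 1F)) → SameOrbit (0F , 0F , 1F) v)))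
    × OrbitSize (0F , 0F , 1F) p
    × OrbitSize (1F , 0F , 1F) ((p * (p ∸ 1)) / 2)
    × (∀ n → NonSquare n →
         OrbitSize (n , 0F , 1F) ((p * (p ∸ 1)) / 2)
         × AllPairs (λ v w → ¬ SameOrbit v w)
             ((1F , 0F , 0F) ∷ (0F , 1F , 0F) ∷ (0F , 0F , 1F) ∷ (1F , 0F , 1F) ∷ (n , 0F , 1F) ∷ [])
         × (∀ v → NonzeroV v →
              SameOrbit (1F , 0F , 0F) v ⊎ SameOrbit (0F , 1F , 0F) v ⊎ SameOrbit (0F , 0F , 1F) v
              ⊎ SameOrbit (1F , 0F , 1F) v ⊎ SameOrbit (n , 0F , 1F) v))
    × (5 ≤ p → ∀ r → NonzeroV r → OrbitSize r p →
         ¬ (∀ w → NonzeroV w → SameOrbit r w → cCoord w ≡ 0F) →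
         SameOrbit (0F , 0F , 1F) r)

module OddPrimeField (k : ℕ) (p-prime : Prime (suc (k +ℕ k))) where

  open Conjugation (k +ℕ k) p-prime public

  1≤k : 1 ≤ k
  1≤k = half-positive k 1<p
    where
    half-positive : ∀ m → 1 < suc (m +ℕ m) → 1 ≤ m
    half-positive zero    (s≤s ())
    half-positive (suc _) _ = s≤s z≤n

  -- T enumerates the residues 1, …, k: one from each pair ±x of nonzero residues.
  T : Fin k → F
  T t = suc (toℕ t) mod p

  toℕ-T : ∀ t → toℕ (T t) ≡ suc (toℕ t)
  toℕ-T t = trans (toℕ-mod (suc (toℕ t))) (m<n⇒m%n≡m (s≤s (ℕ.<-≤-trans (toℕ<n t) (ℕ.m≤m+n k k))))

  T≢0 : ∀ t → T t ≢ 0F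
  T≢0 t T≡0 = ℕ.1+n≢0 (trans (sym (toℕ-T t)) (cong toℕ T≡0))

  T+T≢0 : ∀ t s → T t +F T s ≢ 0F
  T+T≢0 t s sum≡0 = ℕ.1+n≢0 (begin
      suc (toℕ t) +ℕ suc (toℕ s)               ≡⟨ sym (m<n⇒m%n≡m sum<p) ⟩
      (suc (toℕ t) +ℕ suc (toℕ s)) % p         ≡⟨ cong₂ (λ m n → (m +ℕ n) % p) (sym (toℕ-T t)) (sym (toℕ-T s)) ⟩
      (toℕ (T t) +ℕ toℕ (T s)) % p             ≡⟨ sym (toℕ-mod (toℕ (T t) +ℕ toℕ (T s))) ⟩
      toℕ (T t +F T s)                         ≡⟨ cong toℕ sum≡0 ⟩
      0                                        ∎)
    where
    open ≡-Reasoning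
    sum<p : suc (toℕ t) +ℕ suc (toℕ s) < p
    sum<p = s≤s (ℕ.+-mono-≤ (toℕ<n t) (toℕ<n s))

  2≢0 : 1F +F 1F ≢ 0F
  2≢0 = subst (λ one → one +F one ≢ 0F) Tt₀≡1 (T+T≢0 t₀ t₀)
    where
    t₀ = Fin.fromℕ< 1≤k
    Tt₀≡1 : T t₀ ≡ 1F
    Tt₀≡1 = cong (λ n → suc n mod p) (toℕ-fromℕ< 1≤k)

  T²-injective : ∀ t s → T t *F T t ≡ T s *F T s → t ≡ s
  T²-injective t s t²≡s² = Sum.[ t-s≡0⇒t≡s , (λ t+s≡0 → contradiction t+s≡0 (T+T≢0 t s)) ]′
    (x*y≡0⇒x≡0∨y≡0 (T t +F -F T s) (T t +F T s) [t-s][t+s]≡0)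
    where
    [t-s][t+s]≡0 : (T t +F -F T s) *F (T t +F T s) ≡ 0F
    [t-s][t+s]≡0 = trans (solve 2 (λ x y → (x :+ :- y) :* (x :+ y) := x :* x :+ :- (y :* y)) refl (T t) (T s))
                         (trans (cong (λ w → w +F -F (T s *F T s)) t²≡s²) (-‿inverseʳ (T s *F T s)))
    t-s≡0⇒t≡s : T t +F -F T s ≡ 0F → t ≡ s
    t-s≡0⇒t≡s t-s≡0 = toℕ-injective (ℕ.suc-injective
      (trans (sym (toℕ-T t)) (trans (cong toℕ (x-y≡0⇒x≡y (T t) (T s) t-s≡0)) (toℕ-T s))))

  T-onto : ∀ y → y ≢ 0F → toℕ y ≤ k → ∃ λ t → T t ≡ y
  T-onto y y≢0 y≤k with toℕ y in toℕy≡
  ... | zero  = contradiction (toℕ-injective toℕy≡) y≢0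
  ... | suc m = Fin.fromℕ< y≤k , toℕ-injective (trans (toℕ-T _) (trans (cong suc (toℕ-fromℕ< y≤k)) (sym toℕy≡)))

  square≡T² : ∀ x → x ≢ 0F → ∃ λ t → T t *F T t ≡ x *F x
  square≡T² x x≢0 with toℕ x ℕ.≤? k
  ... | yes x≤k = let (t , Tt≡x) = T-onto x x≢0 x≤k in t , cong₂ _*F_ Tt≡x Tt≡x
  ... | no  x≰k = let (t , Tt≡-x) = T-onto (-F x) (-x≢0 x x≢0) -x≤k in
    t , trans (cong₂ _*F_ Tt≡-x Tt≡-x) (solve 1 (λ x → :- x :* :- x := x :* x) refl x)
    where
    -x≤k : toℕ (-F x) ≤ k
    -x≤k = subst (_≤ k) (sym (toℕ-neg x x≢0))
      (ℕ.≤-trans (ℕ.∸-monoʳ-≤ p (ℕ.≰⇒> x≰k)) (ℕ.≤-reflexive (ℕ.m+n∸m≡n k k)))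

  -- If they were, j ↦ (the T-root of j + 1) would inject the k + k nonzero residues into Fin k.
  not-all-squares : ¬ (∀ (j : Fin (k +ℕ k)) → IsSquare (Fin.suc j))
  not-all-squares all-squares = contradiction (injective⇒≤ T-root-injective) (ℕ.<⇒≱ (ℕ.m<m+n k 1≤k))
    where
    T-root : Fin (k +ℕ k) → Fin k
    T-root j = let (s , ss≡) = all-squares j in proj₁ (square≡T² s (root≢0 ss≡ (λ ())))
    T-root-spec : ∀ j → T (T-root j) *F T (T-root j) ≡ Fin.suc j
    T-root-spec j = let (s , ss≡) = all-squares j in trans (proj₂ (square≡T² s (root≢0 ss≡ (λ ())))) ss≡
    T-root-injective : Injective _≡_ _≡_ T-root
    T-root-injective {i} {j} same = Fin.suc-injective
      (trans (sym (T-root-spec i)) (trans (cong (λ t → T t *F T t) same) (T-root-spec j)))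

  nonsquare : Σ F NonSquare
  nonsquare = decidable-stable (any? (λ n → ¬? (n ≟ 0F) ×-dec ¬? (square? n))) λ none →
    not-all-squares λ j → decidable-stable (square? (Fin.suc j)) λ ¬square → none (Fin.suc j , (λ ()) , ¬square)

  SquareClass : F → F → Set
  SquareClass n e = (∃ λ t → T t *F T t ≡ e) ⊎ (∃ λ t → T t *F T t *F n ≡ e)

  module _ {n : F} (n-nonsquare : NonSquare n) where
    private
      n≢0 = proj₁ n-nonsquare
      ¬square = proj₂ n-nonsquare

      H : Fin k ⊎ Fin k → F
      H (inj₁ t) = T t *F T t
      H (inj₂ t) = T t *F T t *F n

      H≢0 : ∀ s → H s ≢ 0F
      H≢0 (inj₁ t) = x≢0∧y≢0⇒x*y≢0 (T≢0 t) (T≢0 t)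
      H≢0 (inj₂ t) = x≢0∧y≢0⇒x*y≢0 (x≢0∧y≢0⇒x*y≢0 (T≢0 t) (T≢0 t)) n≢0

      n-square-if : ∀ t s → T t *F T t ≡ T s *F T s *F n → IsSquare n
      n-square-if t s t²≡s²n = T t *F u , (begin
          T t *F u *F (T t *F u)             ≡⟨ solve 2 (λ x u → x :* u :* (x :* u) := x :* x :* (u :* u)) refl (T t) u ⟩
          T t *F T t *F (u *F u)             ≡⟨ cong (_*F (u *F u)) t²≡s²n ⟩
          T s *F T s *F n *F (u *F u)        ≡⟨ solve 3 (λ y n u → y :* y :* n :* (u :* u) := n :* (y :* u) :* (y :* u))
                                                         refl (T s) n u ⟩
          n *F (T s *F u) *F (T s *F u)      ≡⟨ cong (λ w → n *F w *F w) su≡1 ⟩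
          n *F 1F *F 1F                      ≡⟨ solve 1 (λ n → n :* con (+ 1) :* con (+ 1) := n) refl n ⟩
          n                                  ∎)
        where
        open ≡-Reasoning
        u = proj₁ (inverse (T≢0 s))
        su≡1 = proj₂ (inverse (T≢0 s))

      H-injective : ∀ s s′ → H s ≡ H s′ → s ≡ s′
      H-injective (inj₁ t) (inj₁ s) eq = cong inj₁ (T²-injective t s eq)
      H-injective (inj₂ t) (inj₂ s) eq = cong inj₂ (T²-injective t s
        (*F-cancelˡ _ _ n≢0 (trans (*F-comm n _) (trans eq (*F-comm _ n)))))
      H-injective (inj₁ t) (inj₂ s) eq = contradiction (n-square-if t s eq) ¬square
      H-injective (inj₂ t) (inj₁ s) eq = contradiction (n-square-if s t (sym eq)) ¬square

      G : F → F
      G Fin.zero    = 0F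
      G (Fin.suc j) = H (Fin.splitAt k j)

      G-injective : Injective _≡_ _≡_ G
      G-injective {Fin.zero}  {Fin.zero}  _  = refl
      G-injective {Fin.zero}  {Fin.suc j} eq = contradiction (sym eq) (H≢0 (Fin.splitAt k j))
      G-injective {Fin.suc i} {Fin.zero}  eq = contradiction eq (H≢0 (Fin.splitAt k i))
      G-injective {Fin.suc i} {Fin.suc j} eq = cong Fin.suc (begin
          i                              ≡⟨ sym (join-splitAt k k i) ⟩
          Fin.join k k (Fin.splitAt k i) ≡⟨ cong (Fin.join k k) (H-injective (Fin.splitAt k i) (Fin.splitAt k j) eq) ⟩
          Fin.join k k (Fin.splitAt k j) ≡⟨ join-splitAt k k j ⟩
          j                              ∎)
        where open ≡-Reasoning

      classify : ∀ {e} s → H s ≡ e → SquareClass n e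
      classify (inj₁ t) eq = inj₁ (t , eq)
      classify (inj₂ t) eq = inj₂ (t , eq)

    -- The 2k values T t² and T t² n are distinct and nonzero, so together with 0 they exhaust F.
    squareClass : ∀ e → e ≢ 0F → SquareClass n e
    squareClass e e≢0 with injective⇒surjective G-injective e
    ... | Fin.zero  , 0≡e  = contradiction (sym 0≡e) e≢0
    ... | Fin.suc j , Gj≡e = classify (Fin.splitAt k j) Gj≡e

  orbitLine : F → Fin k × F → V
  orbitLine d (t , a) = act (T t) a (d , 0F , 1F)

  orbitLine-injective : ∀ {d} → d ≢ 0F → ∀ ta sb → SameLine (orbitLine d ta) (orbitLine d sb) → ta ≡ sb
  orbitLine-injective {d} d≢0 (t , a) (s , b) same = cong₂ _,_ t≡s a≡b
    where
    eq : (T t *F T t *F d +F -F (a *F a) , a , 1F) ≡ (T s *F T s *F d +F -F (b *F b) , b , 1F)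
    eq = sameLine-c≡1 (subst₂ SameLine (act-[d,0,1] (T t) a d) (act-[d,0,1] (T s) b d) same)
    a≡b : a ≡ b
    a≡b = cong (proj₁ ∘ proj₂) eq
    t²d≡s²d : T t *F T t *F d ≡ T s *F T s *F d
    t²d≡s²d = +-cancelʳ (-F (a *F a)) (T t *F T t *F d) (T s *F T s *F d)
      (trans (cong proj₁ eq) (cong (λ z → T s *F T s *F d +F -F (z *F z)) (sym a≡b)))
    t≡s : t ≡ s
    t≡s = T²-injective t s (*F-cancelˡ (T t *F T t) (T s *F T s) d≢0
      (trans (*F-comm d (T t *F T t)) (trans t²d≡s²d (*F-comm (T s *F T s) d))))

  sameOrbit⇒orbitLine : ∀ {d w} → SameOrbit (d , 0F , 1F) w → ∃ λ ta → SameLine w (orbitLine d ta)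
  sameOrbit⇒orbitLine {d} {w} r∼w =
    let (x , y , x≢0 , w∼xr) = sameOrbit⇒act r∼w
        (t , Tt²≡x²) = square≡T² x x≢0
    in (t , y) , subst (SameLine w) (begin
      act x y (d , 0F , 1F)                       ≡⟨ act-[d,0,1] x y d ⟩
      (x *F x *F d +F -F (y *F y) , y , 1F)       ≡⟨ cong (λ z → (z *F d +F -F (y *F y) , y , 1F)) (sym Tt²≡x²) ⟩
      (T t *F T t *F d +F -F (y *F y) , y , 1F)   ≡⟨ sym (act-[d,0,1] (T t) y d) ⟩
      act (T t) y (d , 0F , 1F)                   ∎) w∼xr
    where open ≡-Reasoning

  orbitLine-inOrbit : ∀ d ta → NonzeroV (orbitLine d ta) × SameOrbit (d , 0F , 1F) (orbitLine d ta)
  orbitLine-inOrbit d (t , a) = nonzero-c≡1 , act⇒sameOrbit (T≢0 t) (sameLine-refl _)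

  orbitLineₙ : F → Fin (k * p) → V
  orbitLineₙ d i = orbitLine d (Fin.remQuot {k} p i)

  orbitLineₙ-injective : ∀ {d} → d ≢ 0F → ∀ {i j} → SameLine (orbitLineₙ d i) (orbitLineₙ d j) → i ≡ j
  orbitLineₙ-injective d≢0 {i} {j} same = begin
      i                                             ≡⟨ sym (combine-remQuot {k} p i) ⟩
      uncurry Fin.combine (Fin.remQuot {k} p i)     ≡⟨ cong (uncurry Fin.combine) (orbitLine-injective d≢0 _ _ same) ⟩
      uncurry Fin.combine (Fin.remQuot {k} p j)     ≡⟨ combine-remQuot {k} p j ⟩
      j                                             ∎
    where open ≡-Reasoning

  orbitSize-[d,0,1] : ∀ d → d ≢ 0F → OrbitSize (d , 0F , 1F) (k * p)
  orbitSize-[d,0,1] d d≢0 = orbitSize-tabulate _ (orbitLineₙ d) (λ i → orbitLine-inOrbit d _) (orbitLineₙ-injective d≢0)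
    λ w _ r∼w → let ((t , a) , w∼ta) = sameOrbit⇒orbitLine r∼w in
      Fin.combine t a , subst (SameLine w ∘ orbitLine d) (sym (remQuot-combine t a)) w∼ta

  k*p≡p[p-1]/2 : k * p ≡ (p * (p ∸ 1)) / 2
  k*p≡p[p-1]/2 = trans (sym (m*n/n≡m (k * p) 2)) (cong (_/ 2) (k*[2k+1]*2≡[2k+1]*2k k))
    where
    k*[2k+1]*2≡[2k+1]*2k : ∀ k → k * suc (k +ℕ k) * 2 ≡ suc (k +ℕ k) * (k +ℕ k)
    k*[2k+1]*2≡[2k+1]*2k = solve-∀

  sameOrbit-[b,0,0] : ∀ {b a c} → b ≢ 0F → a ≡ 0F → c ≡ 0F → SameOrbit (1F , 0F , 0F) (b , a , c)
  sameOrbit-[b,0,0] {b} b≢0 a≡0 c≡0 = sameOrbit-sameLine (sameOrbit-refl _)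
    (b , b≢0 , ≡-triple (sym (*-identityʳ b)) (trans a≡0 (sym (zeroʳ b))) (trans c≡0 (sym (zeroʳ b))))

  sameOrbit-[b,a,0] : ∀ {b a c} → a ≢ 0F → c ≡ 0F → SameOrbit (0F , 1F , 0F) (b , a , c)
  sameOrbit-[b,a,0] {b} {a} a≢0 c≡0 = sameOrbit-sameLine (sameOrbit-[0,1,0]-upperLine 2≢0 (a′ *F b))
    (a , a≢0 , ≡-triple (*F-solveˡ {a′} (trans (*F-comm a′ a) aa′≡1) refl) (sym (*-identityʳ a))
                        (trans c≡0 (sym (zeroʳ a))))
    where
    a′ = proj₁ (inverse a≢0)
    aa′≡1 = proj₂ (inverse a≢0)

  sameOrbit-c≡0 : ∀ v → NonzeroV v → cCoord v ≡ 0F → SameOrbit (1F , 0F , 0F) v ⊎ SameOrbit (0F , 1F , 0F) v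
  sameOrbit-c≡0 (b , a , c) v≢0 c≡0 = Sum.map
    (λ a≡0 → sameOrbit-[b,0,0] (λ b≡0 → v≢0 (≡-triple b≡0 a≡0 c≡0)) a≡0 c≡0)
    (λ a≢0 → sameOrbit-[b,a,0] a≢0 c≡0)
    (toSum (a ≟ 0F))

  module _ {n : F} (n-nonsquare : NonSquare n) where

    sameOrbit-[e,0,1] : ∀ e → Dec (e ≡ 0F) →
      SameOrbit (0F , 0F , 1F) (e , 0F , 1F) ⊎ SameOrbit (1F , 0F , 1F) (e , 0F , 1F) ⊎ SameOrbit (n , 0F , 1F) (e , 0F , 1F)
    sameOrbit-[e,0,1] e (yes e≡0) = inj₁ (subst (λ z → SameOrbit (0F , 0F , 1F) (z , 0F , 1F)) (sym e≡0) (sameOrbit-refl _))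
    sameOrbit-[e,0,1] e (no e≢0)  = inj₂ (Sum.map
      (λ (t , Tt²≡e) → sameOrbit-[d,0,1]-square (T t) (T≢0 t) (trans (*-identityʳ (T t *F T t)) Tt²≡e))
      (λ (t , Tt²n≡e) → sameOrbit-[d,0,1]-square (T t) (T≢0 t) Tt²n≡e)
      (squareClass n-nonsquare e e≢0))

    sameOrbit-c≢0 : ∀ v → cCoord v ≢ 0F →
      SameOrbit (0F , 0F , 1F) v ⊎ SameOrbit (1F , 0F , 1F) v ⊎ SameOrbit (n , 0F , 1F) v
    sameOrbit-c≢0 v c≢0 = Sum.map then-v (Sum.map then-v then-v) (sameOrbit-[e,0,1] e (e ≟ 0F))
      where
      e = proj₁ (sameOrbit-normalForm v c≢0)
      then-v : ∀ {r} → SameOrbit r (e , 0F , 1F) → SameOrbit r v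
      then-v r∼e = sameOrbit-trans r∼e (proj₂ (sameOrbit-normalForm v c≢0))

    sameOrbit-exhaustive : ∀ v → NonzeroV v →
      SameOrbit (1F , 0F , 0F) v ⊎ SameOrbit (0F , 1F , 0F) v ⊎ SameOrbit (0F , 0F , 1F) v
      ⊎ SameOrbit (1F , 0F , 1F) v ⊎ SameOrbit (n , 0F , 1F) v
    sameOrbit-exhaustive v v≢0 = Sum.[ (λ c≡0 → Sum.map₂ inj₁ (sameOrbit-c≡0 v v≢0 c≡0))
                                     , (λ c≢0 → inj₂ (inj₂ (sameOrbit-c≢0 v c≢0))) ]′ (toSum (cCoord v ≟ 0F))

    orbits-distinct : AllPairs (λ v w → ¬ SameOrbit v w)
      ((1F , 0F , 0F) ∷ (0F , 1F , 0F) ∷ (0F , 0F , 1F) ∷ (1F , 0F , 1F) ∷ (n , 0F , 1F) ∷ [])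
    orbits-distinct =
      (¬sameOrbit-disc disc[1,0,0]≡0 disc[0,1,0]≢0 ∷ ¬c ∷ ¬c ∷ ¬c ∷ []) ∷
      (¬c ∷ ¬c ∷ ¬c ∷ []) ∷
      (¬sameOrbit-disc (disc-[b,0,1] 0F) (subst (_≢ 0F) (sym (disc-[b,0,1] 1F)) 1F≢0F) ∷
       ¬sameOrbit-disc (disc-[b,0,1] 0F) (subst (_≢ 0F) (sym (disc-[b,0,1] n)) (proj₁ n-nonsquare)) ∷ []) ∷
      (¬[1,0,1]∼[n,0,1] ∷ []) ∷ [] ∷ []
      where
      ¬c : ∀ {b a b′ a′} → ¬ SameOrbit (b , a , 0F) (b′ , a′ , 1F)
      ¬c = ¬sameOrbit-cCoord refl 1F≢0F
      disc[1,0,0]≡0 : disc (1F , 0F , 0F) ≡ 0F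
      disc[1,0,0]≡0 = solve 0 (con (+ 0) :* con (+ 0) :+ con (+ 1) :* con (+ 0) := con (+ 0)) refl
      disc[0,1,0]≢0 : disc (0F , 1F , 0F) ≢ 0F
      disc[0,1,0]≢0 = subst (_≢ 0F) (solve 0 (con (+ 1) := con (+ 1) :* con (+ 1) :+ con (+ 0) :* con (+ 0)) refl) 1F≢0F
      ¬[1,0,1]∼[n,0,1] : ¬ SameOrbit (1F , 0F , 1F) (n , 0F , 1F)
      ¬[1,0,1]∼[n,0,1] r∼n = let (t , _ , n≡tt1) = sameOrbit-disc r∼n in
        proj₂ n-nonsquare (t , sym (trans (sym (disc-[b,0,1] n)) (trans n≡tt1
          (trans (cong (t *F t *F_) (disc-[b,0,1] 1F)) (*-identityʳ (t *F t))))))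

  2≤k : 5 ≤ p → 2 ≤ k
  2≤k = half-≥2 k
    where
    half-≥2 : ∀ m → 5 ≤ suc (m +ℕ m) → 2 ≤ m
    half-≥2 zero          (s≤s ())
    half-≥2 (suc zero)    (s≤s (s≤s (s≤s ())))
    half-≥2 (suc (suc _)) _ = s≤s (s≤s z≤n)

  -- A line with c ≠ 0 and nonzero invariant has an orbit of k p > p lines.
  orbitSize≡p⇒sameOrbit-[0,0,1] : 5 ≤ p → ∀ r → OrbitSize r p →
    ¬ (∀ w → NonzeroV w → SameOrbit r w → cCoord w ≡ 0F) → SameOrbit (0F , 0F , 1F) r
  orbitSize≡p⇒sameOrbit-[0,0,1] 5≤p r size not-upper =
    Sum.[ (λ e≡0 → subst (λ z → SameOrbit (z , 0F , 1F) r) e≡0 e∼r)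
        , (λ e≢0 → contradiction (distinctLines≤orbitSize r (orbitLineₙ e) size in-orbit-of-r
                                                           (orbitLineₙ-injective e≢0)) p≰k*p)
        ]′ (toSum (e ≟ 0F))
    where
    c≢0 : cCoord r ≢ 0F
    c≢0 c≡0 = not-upper (λ w _ r∼w → sameOrbit-cCoord≡0 r∼w c≡0)
    e = proj₁ (sameOrbit-normalForm r c≢0)
    e∼r = proj₂ (sameOrbit-normalForm r c≢0)
    in-orbit-of-r : ∀ i → NonzeroV (orbitLineₙ e i) × SameOrbit r (orbitLineₙ e i)
    in-orbit-of-r i = nonzero-c≡1 , sameOrbit-trans (sameOrbit-sym e∼r) (proj₂ (orbitLine-inOrbit e _))
    p≰k*p : ¬ (k * p ≤ p)
    p≰k*p = ℕ.<⇒≱ (ℕ.<-≤-trans (ℕ.m<m+n p (s≤s z≤n)) (subst (_≤ k * p) (cong (p +ℕ_) (ℕ.+-identityʳ p))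
                                                      (ℕ.*-monoˡ-≤ p (2≤k 5≤p))))

  orbitClassification : OrbitClassification p
  orbitClassification =
    nonsquare ,
    (λ _ _ → sameOrbit-[1,0,0]⇒sameLine , sameOrbit-sameLine (sameOrbit-refl _)) ,
    orbitSize-[1,0,0] ,
    (λ _ _ → sameOrbit-[0,1,0]⇒upperLine , λ (b , v∼b) → sameOrbit-sameLine (sameOrbit-[0,1,0]-upperLine 2≢0 b) v∼b) ,
    orbitSize-[0,1,0] 2≢0 ,
    (λ _ _ → sameOrbit-[0,0,1]⇒nilpotentLine , λ (a , v∼a) → sameOrbit-sameLine (sameOrbit-[0,0,1]-nilpotentLine a) v∼a) ,
    orbitSize-[0,0,1] ,
    subst (OrbitSize (1F , 0F , 1F)) k*p≡p[p-1]/2 (orbitSize-[d,0,1] 1F 1F≢0F) ,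
    (λ n n-nonsquare → subst (OrbitSize (n , 0F , 1F)) k*p≡p[p-1]/2 (orbitSize-[d,0,1] n (proj₁ n-nonsquare)) ,
                       orbits-distinct n-nonsquare , sameOrbit-exhaustive n-nonsquare) ,
    (λ 5≤p r _ → orbitSize≡p⇒sameOrbit-[0,0,1] 5≤p r)

lemma6p7 : (p : ℕ) .{{_ : NonZero p}} → Prime p → p ≢ 2 →
    let open Fp p in
    (Σ F NonSquare)
    × (∀ v → NonzeroV v → ((SameOrbit (1F , 0F , 0F) v → SameLine v (1F , 0F , 0F))
                          × (SameLine v (1F , 0F , 0F) → SameOrbit (1F , 0F , 0F) v)))
    × OrbitSize (1F , 0F , 0F) 1
    × (∀ v → NonzeroV v → ((SameOrbit (0F , 1F , 0F) v → Σ F λ b → SameLine v (b , 1F , 0F))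
                          × ((Σ F λ b → SameLine v (b , 1F , 0F)) → SameOrbit (0F , 1F , 0F) v)))
    × OrbitSize (0F , 1F , 0F) p
    × (∀ v → NonzeroV v → ((SameOrbit (0F , 0F , 1F) v → Σ F λ a → SameLine v (-F (a *F a) , a , 1F))
                          × ((Σ F λ a → SameLine v (-F (a *F a) , a , 1F)) → SameOrbit (0F , 0F , 1F) v)))
    × OrbitSize (0F , 0F , 1F) p
    × OrbitSize (1F , 0F , 1F) ((p * (p ∸ 1)) / 2)
    × (∀ n → NonSquare n →
         OrbitSize (n , 0F , 1F) ((p * (p ∸ 1)) / 2)
         × AllPairs (λ v w → ¬ SameOrbit v w)
             ((1F , 0F , 0F) ∷ (0F , 1F , 0F) ∷ (0F , 0F , 1F) ∷ (1F , 0F , 1F) ∷ (n , 0F , 1F) ∷ [])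
         × (∀ v → NonzeroV v →
              SameOrbit (1F , 0F , 0F) v ⊎ SameOrbit (0F , 1F , 0F) v ⊎ SameOrbit (0F , 0F , 1F) v
              ⊎ SameOrbit (1F , 0F , 1F) v ⊎ SameOrbit (n , 0F , 1F) v))
    × (5 ≤ p → ∀ r → NonzeroV r → OrbitSize r p →
         ¬ (∀ w → NonzeroV w → SameOrbit r w → cCoord w ≡ 0F) →
         SameOrbit (0F , 0F , 1F) r)
lemma6p7 p p-prime p≢2 = classification (odd-prime p-prime p≢2)
  where
  classification : (∃ λ k → p ≡ suc (k +ℕ k)) → OrbitClassification p
  classification (k , refl) = OddPrimeField.orbitClassification k p-prime
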